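{- The exclusive-read (ER) version of the equivalence class sorting problem on $n$ elements with $k$ equivalence classes can be solved in $O(k\log n)$ parallel rounds of equivalence tests, using $n$ processors in Valiant's parallel comparison model.
   Context: Equivalence class sorting (ECS): given a set $S$ of $n$ elements and an (unknown) equivalence relation on $S$ with $k$ equivalence classes, determine the partition of $S$ into its equivalence classes, where the only operation giving information about the relation is a pairwise equivalence test on two elements $x,y\in S$, which reveals only whether $x$ and $y$ are equivalent or not. Valiant's parallel comparison model: computation proceeds in synchronous rounds; in each round each of the $n$ processors may perform one equivalence test, and the tests chosen in a round may depend on the outcomes of all tests in earlier rounds; only the number of rounds containing tests is counted (all other computation is free). In the ER (exclusive-read) version, each element of $S$ may take part in at most one equivalence test in any given round. -}

module Defs where

open import Level using (0ℓ)
open import Data.Nat using (ℕ; zero; suc; _≤_)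
open import Data.Bool using (Bool)
open import Data.Fin using (Fin)
open import Data.Product using (_×_; _,_; Σ; ∃)
open import Data.List using (List; []; _∷_; _++_; length; concatMap; map)
open import Data.List.Relation.Unary.Unique.Propositional using (Unique)
open import Data.Maybe using (Maybe; just; nothing)
open import Function using (Surjective)
open import Function.Bundles using (_⇔_)
open import Relation.Binary using (Rel; IsEquivalence; Decidable)
open import Relation.Binary.PropositionalEquality using (_≡_)
open import Relation.Nullary using (does)

-- An equivalence relation on Fin n whose equivalence test is decidable
-- (the oracle answers each test).
record EqRel (n : ℕ) : Set₁ where
  field
    _∼_     : Rel (Fin n) 0ℓ
    isEquiv : IsEquivalence _∼_
    test    : Decidable _∼_
open EqRel public

-- R has exactly k equivalence classes: the classes are in bijection with
-- Fin k, i.e. there is a surjective class-labelling f : Fin n → Fin k with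
-- f x ≡ f y iff x ∼ y.
HasClasses : ∀ {n} → EqRel n → ℕ → Set
HasClasses {n} R k =
  Σ (Fin n → Fin k) λ f →
    Surjective _≡_ _≡_ f × (∀ x y → (f x ≡ f y) ⇔ (_∼_ R x y))

participants : ∀ {n} → List (Fin n × Fin n) → List (Fin n)
participants = concatMap (λ { (x , y) → x ∷ y ∷ [] })

-- ER constraint: each element takes part in at most one test of the round.
ExclusiveRead : ∀ {n} → List (Fin n × Fin n) → Set
ExclusiveRead ps = Unique (participants ps)

record Round (n : ℕ) : Set where
  constructor round
  field
    tests : List (Fin n × Fin n)
    procs : length tests ≤ n
    er    : ExclusiveRead tests
open Round public

History : ℕ → Set
History n = List (List ((Fin n × Fin n) × Bool))

data Step (n : ℕ) : Set where
  done : (Fin n → ℕ) → Step n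
  next : Round n → Step n

-- A deterministic adaptive algorithm in Valiant's model: the next step is an
-- arbitrary (free) function of all test outcomes seen so far.
Algorithm : ℕ → Set
Algorithm n = History n → Step n

answer : ∀ {n} → EqRel n → List (Fin n × Fin n) → List ((Fin n × Fin n) × Bool)
answer R = map (λ { (x , y) → ((x , y) , does (test R x y)) })

run : ∀ {n} → Algorithm n → EqRel n → ℕ → History n → Maybe (Fin n → ℕ)
run A R t h with A h
... | done f = just f
run A R zero h    | next r = nothing
run A R (suc t) h | next r = run A R t (h ++ (answer R (tests r) ∷ []))

SolvesWithin : ∀ {n} → Algorithm n → EqRel n → ℕ → Set
SolvesWithin {n} A R t =
  Σ (Fin n → ℕ) λ f →
    (run A R t [] ≡ just f) × (∀ x y → (f x ≡ f y) ⇔ (_∼_ R x y))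

-- The classes are assembled by merging.  Initially every element forms a block with a single
-- class; at each of ⌈log₂ n⌉ levels the blocks are paired up and each pair is merged by testing
-- every representative of one block against every representative of the other.  The
-- representatives of a block are pairwise inequivalent, so a block has at most k of them, and
-- each test of a level shares an element with at most 2k tests of that level, itself included.
-- A level therefore takes at most 2k exclusive-read rounds: each round performs a greedy maximal
-- matching of the pending tests, and a pending test left out meets a test of the matching, so
-- its number of pending neighbours drops.  After the last level a single block remains, and the
-- position of an element's class in it is a label for the element's equivalence class.

module Submission where

open import Defs
open import Data.Nat using (ℕ; _*_)
open import Data.Nat.Logarithm using (⌈log₂_⌉)
open import Data.Product using (Σ)

open import Data.Bool as Bool using (Bool; true)
open import Data.Empty using (⊥; ⊥-elim)
open import Data.Fin as Fin using (Fin)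
open import Data.Fin.Properties using (pigeonhole; <⇒≢)
open import Data.List
  using (List; []; _∷_; _++_; length; map; filter; lookup; concatMap; cartesianProduct; allFin)
open import Data.List.Properties
  using (++-identityʳ; ++-assoc; filter-notAll; length-map; length-tabulate)
import Data.List.Membership.DecPropositional as DecMembership
open import Data.List.Membership.Propositional using (_∈_; _∉_; find)
open import Data.List.Membership.Propositional.Properties
  using ( ∈-lookup; ∈-allFin; ∈-map⁺; ∈-++⁺ˡ; ∈-++⁺ʳ; ∈-++⁻; ∈-filter⁺; ∈-filter⁻
        ; ∈-cartesianProduct⁺)
open import Data.List.Relation.Binary.Sublist.Propositional
  using (_⊆_; []; _∷_; _∷ʳ_; ⊆-refl; ⊆-trans) renaming (lookup to Any-resp-⊆)
open import Data.List.Relation.Binary.Sublist.Propositional.Properties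
  using (filter-⊆; All-resp-⊆) renaming (++⁺ˡ to ⊆-++⁺ˡ; ++⁺ʳ to ⊆-++⁺ʳ; ++⁺ to ⊆-++⁺)
open import Data.List.Relation.Unary.All as All using (All; []; _∷_)
import Data.List.Relation.Unary.All.Properties as All
open import Data.List.Relation.Unary.AllPairs as AllPairs using (AllPairs; []; _∷_)
import Data.List.Relation.Unary.AllPairs.Properties as AllPairs
open import Data.List.Relation.Unary.Any as Any using (Any; here; there)
import Data.List.Relation.Unary.Any.Properties as Any
open import Data.List.Relation.Unary.Unique.Propositional using (Unique)
open import Data.List.Relation.Unary.Unique.Propositional.Properties using (allFin⁺)
open import Data.Maybe using (just)
open import Data.Nat using (zero; suc; _+_; _∸_; _≤_; _<_; z≤n; s≤s; _≤?_; ⌈_/2⌉)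
open import Data.Nat.Logarithm using (⌈log₂⌉-mono-≤; ⌈log₂⌈n/2⌉⌉≡⌈log₂n⌉∸1)
open import Data.Nat.Properties
  using ( ≤-refl; ≤-reflexive; ≤-trans; ≤-pred; ≰⇒>; m≤n⇒m≤1+n; m≤n+m; m≤m+n
        ; +-suc; +-mono-≤; +-monoˡ-≤; *-monoˡ-≤; *-monoʳ-≤; *-identityʳ; ∸-monoˡ-≤
        ; suc-injective; module ≤-Reasoning)
open import Data.Nat.Tactic.RingSolver using (solve-∀)
open import Data.Product using (_×_; _,_; proj₁; proj₂; ∃)
open import Data.Product.Properties using (≡-dec)
open import Data.Sum using (_⊎_; inj₁; inj₂; [_,_])
open import Function using (id; _⇔_; mk⇔; Equivalence)
open import Relation.Binary using (IsEquivalence; Decidable)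
open import Relation.Binary.PropositionalEquality using (_≡_; _≢_; refl; sym; trans; cong; subst)
open import Relation.Nullary using (Dec; yes; no; ¬_; does; ¬?; _×-dec_; _⊎-dec_)

module Counting {A : Set} where

  count : {P : A → Set} → (∀ x → Dec (P x)) → List A → ℕ
  count P? [] = 0
  count P? (x ∷ xs) with P? x
  ... | yes _ = suc (count P? xs)
  ... | no  _ = count P? xs

  module _ {P : A → Set} (P? : ∀ x → Dec (P x)) where

    count-++ : ∀ xs ys → count P? (xs ++ ys) ≡ count P? xs + count P? ys
    count-++ [] ys = refl
    count-++ (x ∷ xs) ys with P? x
    ... | yes _ = cong suc (count-++ xs ys)
    ... | no  _ = count-++ xs ys

    count-≤-length : ∀ xs → count P? xs ≤ length xs
    count-≤-length [] = z≤n
    count-≤-length (x ∷ xs) with P? x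
    ... | yes _ = s≤s (count-≤-length xs)
    ... | no  _ = m≤n⇒m≤1+n (count-≤-length xs)

    count-mono-⊆ : ∀ {xs ys} → xs ⊆ ys → count P? xs ≤ count P? ys
    count-mono-⊆ [] = z≤n
    count-mono-⊆ (y ∷ʳ xs⊆ys) with P? y
    ... | yes _ = m≤n⇒m≤1+n (count-mono-⊆ xs⊆ys)
    ... | no  _ = count-mono-⊆ xs⊆ys
    count-mono-⊆ {x ∷ _} (refl ∷ xs⊆ys) with P? x
    ... | yes _ = s≤s (count-mono-⊆ xs⊆ys)
    ... | no  _ = count-mono-⊆ xs⊆ys

    count-≤-∷ : ∀ x {xs} → count P? xs ≤ count P? (x ∷ xs)
    count-≤-∷ x = count-mono-⊆ (x ∷ʳ ⊆-refl)

    count-<-∷ : ∀ {x xs} → P x → count P? xs < count P? (x ∷ xs)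
    count-<-∷ {x} px with P? x
    ... | yes _  = ≤-refl
    ... | no ¬px = ⊥-elim (¬px px)

    count-filter-< : ∀ {Q : A → Set} (Q? : ∀ x → Dec (Q x)) {x xs} →
                     x ∈ xs → P x → ¬ Q x → count P? (filter Q? xs) < count P? xs
    count-filter-< Q? {xs = y ∷ ys} x∈ px ¬qx with Q? y
    ... | yes qy with P? y | x∈
    ...   | _      | here refl = ⊥-elim (¬qx qy)
    ...   | yes _  | there x∈' = s≤s (count-filter-< Q? x∈' px ¬qx)
    ...   | no  _  | there x∈' = count-filter-< Q? x∈' px ¬qx
    count-filter-< Q? {xs = y ∷ ys} x∈ px ¬qx | no _ with P? y | x∈
    ...   | no ¬py | here refl = ⊥-elim (¬py px)
    ...   | yes _  | here refl = s≤s (count-mono-⊆ (filter-⊆ Q? ys))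
    ...   | yes _  | there x∈' = m≤n⇒m≤1+n (count-filter-< Q? x∈' px ¬qx)
    ...   | no  _  | there x∈' = count-filter-< Q? x∈' px ¬qx

  module _ {P Q : A → Set} (P? : ∀ x → Dec (P x)) (Q? : ∀ x → Dec (Q x)) where

    count-mono : (∀ {x} → P x → Q x) → ∀ xs → count P? xs ≤ count Q? xs
    count-mono P⇒Q [] = z≤n
    count-mono P⇒Q (x ∷ xs) with P? x | Q? x
    ... | yes _  | yes _  = s≤s (count-mono P⇒Q xs)
    ... | yes px | no ¬qx = ⊥-elim (¬qx (P⇒Q px))
    ... | no  _  | yes _  = m≤n⇒m≤1+n (count-mono P⇒Q xs)
    ... | no  _  | no  _  = count-mono P⇒Q xs

    count-⊎ : ∀ {S : A → Set} (S? : ∀ x → Dec (S x)) → (∀ {x} → S x → P x ⊎ Q x) →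
              ∀ xs → count S? xs ≤ count P? xs + count Q? xs
    count-⊎ S? S⇒P⊎Q [] = z≤n
    count-⊎ S? S⇒P⊎Q (x ∷ xs) with S? x | count-⊎ S? S⇒P⊎Q xs
    ... | no  _  | ih = ≤-trans ih (+-mono-≤ (count-≤-∷ P? x) (count-≤-∷ Q? x))
    ... | yes sx | ih with S⇒P⊎Q sx
    ...   | inj₁ px = ≤-trans (s≤s ih) (+-mono-≤ (count-<-∷ P? px) (count-≤-∷ Q? x))
    ...   | inj₂ qx =
      ≤-trans (s≤s ih) (≤-trans (≤-reflexive (sym (+-suc (count P? xs) (count Q? xs))))
                                (+-mono-≤ (count-≤-∷ P? x) (count-<-∷ Q? qx)))

open Counting public

count-map : ∀ {A B : Set} {P : B → Set} (P? : ∀ x → Dec (P x)) (f : A → B) xs →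
            count P? (map f xs) ≡ count (λ x → P? (f x)) xs
count-map P? f [] = refl
count-map P? f (x ∷ xs) with P? (f x)
... | yes _ = cong suc (count-map P? f xs)
... | no  _ = count-map P? f xs

Unique⇒length≤ : ∀ {m} {xs : List (Fin m)} → Unique xs → length xs ≤ m
Unique⇒length≤ {m} {xs} unique with length xs ≤? m
... | yes ≤m = ≤m
... | no  ≰m with pigeonhole (≰⇒> ≰m) (lookup xs)
... | i , j , i<j , same = ⊥-elim (<⇒≢ i<j (lookup-injective unique i j same))
  where
    lookup-injective : ∀ {ys : List (Fin m)} → Unique ys → ∀ i j →
                       lookup ys i ≡ lookup ys j → i ≡ j
    lookup-injective (_ ∷ _)  Fin.zero    Fin.zero    _  = refl
    lookup-injective (y∉ ∷ _) Fin.zero    (Fin.suc j) eq = ⊥-elim (All.lookup y∉ (∈-lookup j) eq)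
    lookup-injective (y∉ ∷ _) (Fin.suc i) Fin.zero    eq = ⊥-elim (All.lookup y∉ (∈-lookup i) (sym eq))
    lookup-injective (_ ∷ u)  (Fin.suc i) (Fin.suc j) eq = cong Fin.suc (lookup-injective u i j eq)

AllPairs-resp-⊆ : ∀ {A : Set} {R : A → A → Set} {xs ys : List A} →
                  xs ⊆ ys → AllPairs R ys → AllPairs R xs
AllPairs-resp-⊆ []             []          = []
AllPairs-resp-⊆ (_ ∷ʳ xs⊆ys)   (_ ∷ Rys)   = AllPairs-resp-⊆ xs⊆ys Rys
AllPairs-resp-⊆ (refl ∷ xs⊆ys) (Ry ∷ Rys) = All-resp-⊆ xs⊆ys Ry ∷ AllPairs-resp-⊆ xs⊆ys Rys

module Interaction (n : ℕ) where

  Answers : Set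
  Answers = List ((Fin n × Fin n) × Bool)

  data Prog (A : Set) : Set where
    return : A → Prog A
    ask    : Round n → (Answers → Prog A) → Prog A

  _>>=_ : ∀ {A B} → Prog A → (A → Prog B) → Prog B
  return a >>= q = q a
  ask r k  >>= q = ask r (λ as → k as >>= q)

  toAlgorithm : Prog (Fin n → ℕ) → Algorithm n
  toAlgorithm (return f) _       = done f
  toAlgorithm (ask r k)  []      = next r
  toAlgorithm (ask r k)  (a ∷ h) = toAlgorithm (k a) h

  module _ (R : EqRel n) where

    HaltsWithin : ∀ {A} → ℕ → Prog A → (A → Set) → Set
    HaltsWithin t       (return a) P = P a
    HaltsWithin zero    (ask r k)  P = ⊥
    HaltsWithin (suc t) (ask r k)  P = HaltsWithin t (k (answer R (tests r))) P

    HaltsWithin-mono : ∀ {A t t'} (p : Prog A) {P Q : A → Set} → t ≤ t' → (∀ {a} → P a → Q a) →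
                       HaltsWithin t p P → HaltsWithin t' p Q
    HaltsWithin-mono (return a) _ P⇒Q h = P⇒Q h
    HaltsWithin-mono {t = suc t} {suc t'} (ask r k) (s≤s t≤t') P⇒Q h =
      HaltsWithin-mono (k _) t≤t' P⇒Q h

    HaltsWithin->>= : ∀ {A B} t₁ t₂ (p : Prog A) (q : A → Prog B) {P Q} →
                      HaltsWithin t₁ p P → (∀ a → P a → HaltsWithin t₂ (q a) Q) →
                      HaltsWithin (t₁ + t₂) (p >>= q) Q
    HaltsWithin->>= t₁ t₂ (return a) q h hq = HaltsWithin-mono (q a) (m≤n+m t₂ t₁) id (hq a h)
    HaltsWithin->>= (suc t₁) t₂ (ask r k) q h hq = HaltsWithin->>= t₁ t₂ (k _) q h hq

    run-behaving : ∀ (A : Algorithm n) h t p {P} → (∀ h' → A (h ++ h') ≡ toAlgorithm p h') →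
                   HaltsWithin t p P → ∃ λ f → run A R t h ≡ just f × P f
    run-behaving A h t (return f) behaves halts
      with A h | trans (cong A (sym (++-identityʳ h))) (behaves [])
    ... | .(done f) | refl = f , refl , halts
    run-behaving A h (suc t) (ask r k) behaves halts
      with A h | trans (cong A (sym (++-identityʳ h))) (behaves [])
    ... | .(next r) | refl =
      run-behaving A (h ++ ans ∷ []) t (k ans)
        (λ h' → trans (cong A (++-assoc h (ans ∷ []) h')) (behaves (ans ∷ h'))) halts
      where ans = answer R (tests r)

    run-toAlgorithm : ∀ t p {P} → HaltsWithin t p P →
                      ∃ λ f → run (toAlgorithm p) R t [] ≡ just f × P f
    run-toAlgorithm t p = run-behaving (toAlgorithm p) [] t p (λ _ → refl)

module Scheduling (n : ℕ) where

  open Interaction n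

  Pair : Set
  Pair = Fin n × Fin n

  open DecMembership (Fin._≟_ {n}) using (_∈?_)
  open DecMembership (≡-dec (Fin._≟_ {n}) (Fin._≟_ {n}))
    using () renaming (_∈?_ to _∈ᵖ?_; _∉?_ to _∉ᵖ?_)

  Incident : Fin n → Pair → Set
  Incident x (a , b) = a ≡ x ⊎ b ≡ x

  incident? : ∀ x e → Dec (Incident x e)
  incident? x (a , b) = (a Fin.≟ x) ⊎-dec (b Fin.≟ x)

  Adjacent : Pair → Pair → Set
  Adjacent (a , b) e = Incident a e ⊎ Incident b e

  adjacent? : ∀ e e' → Dec (Adjacent e e')
  adjacent? (a , b) e = incident? a e ⊎-dec incident? b e

  degree : List Pair → Pair → ℕ
  degree U e = count (adjacent? e) U

  Available : List (Fin n) → Pair → Set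
  Available used (a , b) = a ∉ used × b ∉ used × a ≢ b

  available? : ∀ used e → Dec (Available used e)
  available? used (a , b) = ¬? (a ∈? used) ×-dec ¬? (b ∈? used) ×-dec ¬? (a Fin.≟ b)

  matching : List (Fin n) → List Pair → List Pair
  matching used [] = []
  matching used (e ∷ U) with available? used e
  ... | yes _ = e ∷ matching (proj₁ e ∷ proj₂ e ∷ used) U
  ... | no  _ = matching used U

  matching-⊆ : ∀ used U → matching used U ⊆ U
  matching-⊆ used [] = []
  matching-⊆ used (e ∷ U) with available? used e
  ... | yes _ = refl ∷ matching-⊆ _ U
  ... | no  _ = e ∷ʳ matching-⊆ used U

  matching-avoids : ∀ used U {z} → z ∈ participants (matching used U) → z ∉ used
  matching-avoids used (e ∷ U) z∈ z∈used with available? used e | z∈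
  ... | yes (a∉ , _) | here refl = a∉ z∈used
  ... | yes (_ , b∉ , _) | there (here refl) = b∉ z∈used
  ... | yes _ | there (there z∈') = matching-avoids _ U z∈' (there (there z∈used))
  ... | no  _ | z∈' = matching-avoids used U z∈' z∈used

  matching-unique : ∀ used U → Unique (participants (matching used U))
  matching-unique used [] = []
  matching-unique used (e ∷ U) with available? used e
  ... | no  _ = matching-unique used U
  ... | yes (_ , _ , a≢b) =
        (a≢b ∷ All.tabulate (λ z∈ a≡z → matching-avoids _ U z∈ (here (sym a≡z))))
      ∷ All.tabulate (λ z∈ b≡z → matching-avoids _ U z∈ (there (here (sym b≡z))))
      ∷ matching-unique _ U

  matching-maximal : ∀ used U {e} → e ∈ U → Available used e →
                     Any (Adjacent e) (matching used U)
  matching-maximal used (e' ∷ U) {e} e∈ av with available? used e' | e∈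
  ... | no ¬av | here refl = ⊥-elim (¬av av)
  ... | no  _  | there e∈' = matching-maximal used U e∈' av
  ... | yes _  | here refl = here (inj₁ (inj₁ refl))
  ... | yes _  | there e∈' with adjacent? e e'
  ...   | yes adj = here adj
  ...   | no ¬adj = there (matching-maximal _ U e∈' (still-available e av ¬adj))
    where
      still-available : ∀ e → Available used e → ¬ Adjacent e e' →
                        Available (proj₁ e' ∷ proj₂ e' ∷ used) e
      still-available (a , b) (a∉ , b∉ , a≢b) ¬adj =
          (λ { (here a≡)          → ¬adj (inj₁ (inj₁ (sym a≡)))
             ; (there (here a≡))  → ¬adj (inj₁ (inj₂ (sym a≡)))
             ; (there (there a∈)) → a∉ a∈ })
        , (λ { (here b≡)          → ¬adj (inj₂ (inj₁ (sym b≡)))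
             ; (there (here b≡))  → ¬adj (inj₂ (inj₂ (sym b≡)))
             ; (there (there b∈)) → b∉ b∈ })
        , a≢b

  length≤participants : ∀ (G : List Pair) → length G ≤ length (participants G)
  length≤participants [] = z≤n
  length≤participants (e ∷ G) = s≤s (m≤n⇒m≤1+n (length≤participants G))

  matchingRound : List Pair → Round n
  matchingRound U = round M (≤-trans (length≤participants M) (Unique⇒length≤ unique)) unique
    where
      M = matching [] U
      unique = matching-unique [] U

  untested : List Pair → List Pair → List Pair
  untested M U = filter (_∉ᵖ? M) U

  -- The fuel d only guarantees termination (the algorithm does not know k); d = length U
  -- suffices, as every round tests at least one pending pair.
  testAll : ℕ → List Pair → Answers → Prog Answers
  testAll zero    U       acc = return acc
  testAll (suc d) []      acc = return acc
  testAll (suc d) (e ∷ U) acc =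
    ask (matchingRound (e ∷ U)) λ ans →
      testAll d (untested (matching [] (e ∷ U)) (e ∷ U)) (ans ++ acc)

  module _ (R : EqRel n) where

    outcome : Pair → Pair × Bool
    outcome (x , y) = (x , y) , does (test R x y)

    Recorded : Answers → Pair → Set
    Recorded ans e = outcome e ∈ ans

    Truthful : Answers → Set
    Truthful = All (λ r → r ≡ outcome (proj₁ r))

    answer-truthful : ∀ G → Truthful (answer R G)
    answer-truthful [] = []
    answer-truthful (e ∷ G) = refl ∷ answer-truthful G

    answer-records : ∀ {G e} → e ∈ G → Recorded (answer R G) e
    answer-records = ∈-map⁺ outcome

    testAll-spec : ∀ B d U acc → length U ≤ d → (∀ {e} → e ∈ U → proj₁ e ≢ proj₂ e) →
                   (∀ {e} → e ∈ U → degree U e ≤ B) → Truthful acc →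
                   HaltsWithin R B (testAll d U acc)
                     (λ ans → Truthful ans × acc ⊆ ans × (∀ {e} → e ∈ U → Recorded ans e))
    testAll-spec B zero [] acc _ _ _ truthful = truthful , ⊆-refl , λ ()
    testAll-spec B (suc d) [] acc _ _ _ truthful = truthful , ⊆-refl , λ ()
    testAll-spec zero (suc d) (e ∷ U) acc _ _ deg _
      with ≤-trans (count-<-∷ (adjacent? e) (inj₁ (inj₁ refl))) (deg (here refl))
    ... | ()
    testAll-spec (suc B) (suc d) (e ∷ U) acc (s≤s |U|≤d) loopless deg truthful =
      HaltsWithin-mono R (testAll d U' (new ++ acc)) ≤-refl conclude
        (testAll-spec B d U' (new ++ acc) |U'|≤d
           (λ e'∈ → loopless (proj₁ (∈-filter⁻ (_∉ᵖ? M) e'∈)))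
           deg' (All.++⁺ (answer-truthful M) truthful))
      where
        M = matching [] (e ∷ U)
        U' = untested M (e ∷ U)
        new = answer R M

        taken-neighbour : ∀ {e'} → e' ∈ e ∷ U → ∃ λ g → g ∈ M × g ∈ e ∷ U × Adjacent e' g
        taken-neighbour e'∈
          with find (matching-maximal [] (e ∷ U) e'∈ ((λ ()) , (λ ()) , loopless e'∈))
        ... | g , g∈M , adj = g , g∈M , Any-resp-⊆ (matching-⊆ [] (e ∷ U)) g∈M , adj

        |U'|≤d : length U' ≤ d
        |U'|≤d with taken-neighbour (here refl)
        ... | g , g∈M , g∈U , _ =
          ≤-trans (≤-pred (filter-notAll (_∉ᵖ? M) (e ∷ U) (Any.map (λ { refl g∉M → g∉M g∈M }) g∈U)))
                  |U|≤d

        deg' : ∀ {e'} → e' ∈ U' → degree U' e' ≤ B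
        deg' {e'} e'∈U' with ∈-filter⁻ (_∉ᵖ? M) e'∈U'
        ... | e'∈U , _ with taken-neighbour e'∈U
        ... | g , g∈M , g∈U , adj =
          ≤-pred (≤-trans (count-filter-< (adjacent? e') (_∉ᵖ? M) g∈U adj (λ g∉M → g∉M g∈M))
                          (deg e'∈U))

        conclude : ∀ {ans} →
                   Truthful ans × (new ++ acc) ⊆ ans × (∀ {e'} → e' ∈ U' → Recorded ans e') →
                   Truthful ans × acc ⊆ ans × (∀ {e'} → e' ∈ e ∷ U → Recorded ans e')
        conclude (truthful' , ⊆ans , recorded) =
          truthful' , ⊆-trans (⊆-++⁺ˡ new ⊆-refl) ⊆ans , covered
          where
            covered : ∀ {e'} → e' ∈ e ∷ U → Recorded _ e'
            covered {e'} e'∈ with e' ∈ᵖ? M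
            ... | yes e'∈M = Any-resp-⊆ ⊆ans (∈-++⁺ˡ (answer-records e'∈M))
            ... | no  e'∉M = recorded (∈-filter⁺ (_∉ᵖ? M) e'∈ e'∉M)

-- A class is a representative together with the other members found so far.
module Merging (n : ℕ) where

  Class : Set
  Class = Fin n × List (Fin n)

  Block : Set
  Block = List Class

  reps : Block → List (Fin n)
  reps = map proj₁

  allReps : List Block → List (Fin n)
  allReps = concatMap reps

  _∈ᶜ_ : Fin n → Class → Set
  x ∈ᶜ (r , xs) = x ≡ r ⊎ x ∈ xs

  _∈ᵇ_ : Fin n → Block → Set
  x ∈ᵇ P = Any (x ∈ᶜ_) P

  _∈ᶜ?_ : ∀ x C → Dec (x ∈ᶜ C)
  x ∈ᶜ? (r , xs) = (x Fin.≟ r) ⊎-dec (x ∈? xs)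
    where open DecMembership (Fin._≟_ {n}) using (_∈?_)

  position : Fin n → Block → ℕ
  position x [] = 0
  position x (C ∷ P) with x ∈ᶜ? C
  ... | yes _ = 0
  ... | no  _ = suc (position x P)

  crossPairs : List Block → List (Fin n × Fin n)
  crossPairs (P ∷ Q ∷ Ps) = cartesianProduct (reps P) (reps Q) ++ crossPairs Ps
  crossPairs _            = []

  module _ {J : Fin n → Fin n → Set} (J? : Decidable J) where

    insert : Class → Block → Block
    insert C [] = C ∷ []
    insert (b , ys) ((a , xs) ∷ P) with J? a b
    ... | yes _ = (a , xs ++ b ∷ ys) ∷ P
    ... | no  _ = (a , xs) ∷ insert (b , ys) P

    merge : Block → Block → Block
    merge P []      = P
    merge P (C ∷ Q) = merge (insert C P) Q

    mergePairs : List Block → List Block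
    mergePairs (P ∷ Q ∷ Ps) = merge P Q ∷ mergePairs Ps
    mergePairs Ps           = Ps

    insert-cover : ∀ {x} C P → x ∈ᶜ C ⊎ x ∈ᵇ P → x ∈ᵇ insert C P
    insert-cover C [] (inj₁ x∈C) = here x∈C
    insert-cover (b , ys) ((a , xs) ∷ P) x∈ with J? a b | x∈
    ... | yes _ | inj₁ (inj₁ refl)       = here (inj₂ (∈-++⁺ʳ xs (here refl)))
    ... | yes _ | inj₁ (inj₂ x∈ys)       = here (inj₂ (∈-++⁺ʳ xs (there x∈ys)))
    ... | yes _ | inj₂ (here (inj₁ x≡a)) = here (inj₁ x≡a)
    ... | yes _ | inj₂ (here (inj₂ x∈xs)) = here (inj₂ (∈-++⁺ˡ x∈xs))
    ... | yes _ | inj₂ (there x∈P)       = there x∈P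
    ... | no  _ | inj₂ (here x∈a)        = here x∈a
    ... | no  _ | inj₂ (there x∈P)       = there (insert-cover (b , ys) P (inj₂ x∈P))
    ... | no  _ | inj₁ x∈C               = there (insert-cover (b , ys) P (inj₁ x∈C))

    merge-cover : ∀ {x} P Q → x ∈ᵇ P ⊎ x ∈ᵇ Q → x ∈ᵇ merge P Q
    merge-cover P [] (inj₁ x∈P) = x∈P
    merge-cover P (C ∷ Q) (inj₁ x∈P) =
      merge-cover (insert C P) Q (inj₁ (insert-cover C P (inj₂ x∈P)))
    merge-cover P (C ∷ Q) (inj₂ (here x∈C)) =
      merge-cover (insert C P) Q (inj₁ (insert-cover C P (inj₁ x∈C)))
    merge-cover P (C ∷ Q) (inj₂ (there x∈Q)) = merge-cover (insert C P) Q (inj₂ x∈Q)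

    mergePairs-cover : ∀ {x} Ps → Any (x ∈ᵇ_) Ps → Any (x ∈ᵇ_) (mergePairs Ps)
    mergePairs-cover (P ∷ []) x∈ = x∈
    mergePairs-cover (P ∷ Q ∷ Ps) (here x∈P)         = here (merge-cover P Q (inj₁ x∈P))
    mergePairs-cover (P ∷ Q ∷ Ps) (there (here x∈Q)) = here (merge-cover P Q (inj₂ x∈Q))
    mergePairs-cover (P ∷ Q ∷ Ps) (there (there x∈)) = there (mergePairs-cover Ps x∈)

    mergePairs-length : ∀ Ps → length (mergePairs Ps) ≡ ⌈ length Ps /2⌉
    mergePairs-length []           = refl
    mergePairs-length (P ∷ [])     = refl
    mergePairs-length (P ∷ Q ∷ Ps) = cong suc (mergePairs-length Ps)

    insert-reps-⊆ : ∀ C P → reps (insert C P) ⊆ reps P ++ proj₁ C ∷ []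
    insert-reps-⊆ C [] = ⊆-refl
    insert-reps-⊆ (b , ys) ((a , xs) ∷ P) with J? a b
    ... | yes _ = refl ∷ ⊆-++⁺ʳ (b ∷ []) ⊆-refl
    ... | no  _ = refl ∷ insert-reps-⊆ (b , ys) P

    merge-reps-⊆ : ∀ P Q → reps (merge P Q) ⊆ reps P ++ reps Q
    merge-reps-⊆ P [] = ⊆-++⁺ʳ [] ⊆-refl
    merge-reps-⊆ P (C ∷ Q) =
      ⊆-trans (merge-reps-⊆ (insert C P) Q)
        (subst (reps (insert C P) ++ reps Q ⊆_) (++-assoc (reps P) (proj₁ C ∷ []) (reps Q))
          (⊆-++⁺ (insert-reps-⊆ C P) ⊆-refl))

    allReps-mergePairs-⊆ : ∀ Ps → allReps (mergePairs Ps) ⊆ allReps Ps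
    allReps-mergePairs-⊆ []           = []
    allReps-mergePairs-⊆ (P ∷ [])     = ⊆-refl
    allReps-mergePairs-⊆ (P ∷ Q ∷ Ps) =
      subst (allReps (mergePairs (P ∷ Q ∷ Ps)) ⊆_) (++-assoc (reps P) (reps Q) (allReps Ps))
        (⊆-++⁺ (merge-reps-⊆ P Q) (allReps-mergePairs-⊆ Ps))

  module Correctness (R : EqRel n) where

    open IsEquivalence (isEquiv R) public
      using () renaming (refl to ≈-refl; sym to ≈-sym; trans to ≈-trans)

    _≈_ : Fin n → Fin n → Set
    _≈_ = _∼_ R

    Coherent : Class → Set
    Coherent (r , xs) = All (r ≈_) xs

    Separated : Block → Set
    Separated P = AllPairs (λ a b → ¬ a ≈ b) (reps P)

    module _ {J : Fin n → Fin n → Set} (J? : Decidable J) (sound : ∀ {a b} → J a b → a ≈ b) where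

      insert-coherent : ∀ C P → Coherent C → All Coherent P → All Coherent (insert J? C P)
      insert-coherent C [] cohC [] = cohC ∷ []
      insert-coherent (b , ys) ((a , xs) ∷ P) cohC (cohA ∷ cohP) with J? a b
      ... | yes jab = All.++⁺ cohA (sound jab ∷ All.map (≈-trans (sound jab)) cohC) ∷ cohP
      ... | no  _   = cohA ∷ insert-coherent (b , ys) P cohC cohP

      merge-coherent : ∀ P Q → All Coherent P → All Coherent Q → All Coherent (merge J? P Q)
      merge-coherent P [] cohP [] = cohP
      merge-coherent P (C ∷ Q) cohP (cohC ∷ cohQ) =
        merge-coherent (insert J? C P) Q (insert-coherent C P cohC cohP) cohQ

      mergePairs-coherent : ∀ Ps → All (All Coherent) Ps → All (All Coherent) (mergePairs J? Ps)
      mergePairs-coherent [] [] = []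
      mergePairs-coherent (P ∷ []) coh = coh
      mergePairs-coherent (P ∷ Q ∷ Ps) (cohP ∷ cohQ ∷ coh) =
        merge-coherent P Q cohP cohQ ∷ mergePairs-coherent Ps coh

      Complete : List (Fin n) → List (Fin n) → Set
      Complete as bs = ∀ {a b} → a ∈ as → b ∈ bs → a ≈ b → J a b

      insert-separated : ∀ C P → Separated P → Complete (reps P) (proj₁ C ∷ []) →
                         Separated (insert J? C P)
      insert-separated C [] [] _ = [] ∷ []
      insert-separated (b , ys) ((a , xs) ∷ P) (a≉P ∷ sepP) complete with J? a b
      ... | yes _   = a≉P ∷ sepP
      ... | no ¬jab =
            All-resp-⊆ (insert-reps-⊆ J? (b , ys) P)
              (All.++⁺ a≉P ((λ a≈b → ¬jab (complete (here refl) (here refl) a≈b)) ∷ []))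
          ∷ insert-separated (b , ys) P sepP (λ a∈ → complete (there a∈))

      merge-separated : ∀ P Q → Separated P → Separated Q → Complete (reps P) (reps Q) →
                        Separated (merge J? P Q)
      merge-separated P [] sepP _ _ = sepP
      merge-separated P (C ∷ Q) sepP (c≉Q ∷ sepQ) complete =
        merge-separated (insert J? C P) Q
          (insert-separated C P sepP (λ a∈ → λ { (here refl) → complete a∈ (here refl) }))
          sepQ complete'
        where
          complete' : Complete (reps (insert J? C P)) (reps Q)
          complete' a∈ b∈ a≈b with ∈-++⁻ (reps P) (Any-resp-⊆ (insert-reps-⊆ J? C P) a∈)
          ... | inj₁ a∈P         = complete a∈P (there b∈) a≈b
          ... | inj₂ (here refl) = ⊥-elim (All.lookup c≉Q b∈ a≈b)

      mergePairs-separated : ∀ Ps → All Separated Ps →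
                             (∀ {a b} → (a , b) ∈ crossPairs Ps → a ≈ b → J a b) →
                             All Separated (mergePairs J? Ps)
      mergePairs-separated [] [] _ = []
      mergePairs-separated (P ∷ []) sep _ = sep
      mergePairs-separated (P ∷ Q ∷ Ps) (sepP ∷ sepQ ∷ sep) complete =
          merge-separated P Q sepP sepQ (λ a∈ b∈ → complete (∈-++⁺ˡ (∈-cartesianProduct⁺ a∈ b∈)))
        ∷ mergePairs-separated Ps sep
            (λ ab∈ → complete (∈-++⁺ʳ (cartesianProduct (reps P) (reps Q)) ab∈))

    rep-≈ : ∀ C {x} → Coherent C → x ∈ᶜ C → proj₁ C ≈ x
    rep-≈ C coh (inj₁ refl) = ≈-refl
    rep-≈ C coh (inj₂ x∈)   = All.lookup coh x∈

    rep-≈-member : ∀ P {x} → All Coherent P → x ∈ᵇ P → ∃ λ r → r ∈ reps P × r ≈ x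
    rep-≈-member (C ∷ P) (cohC ∷ _) (here x∈C) = proj₁ C , here refl , rep-≈ C cohC x∈C
    rep-≈-member (C ∷ P) (_ ∷ cohP) (there x∈P) with rep-≈-member P cohP x∈P
    ... | r , r∈ , r≈x = r , there r∈ , r≈x

    member-≉-later : ∀ C P → Coherent C → All Coherent P → All (λ r → ¬ proj₁ C ≈ r) (reps P) →
                     ∀ {x y} → x ∈ᶜ C → y ∈ᵇ P → ¬ x ≈ y
    member-≉-later C P cohC cohP c≉P x∈C y∈P x≈y with rep-≈-member P cohP y∈P
    ... | r , r∈ , r≈y = All.lookup c≉P r∈ (≈-trans (rep-≈ C cohC x∈C) (≈-trans x≈y (≈-sym r≈y)))

    position-correct : ∀ P → All Coherent P → Separated P → ∀ {x y} → x ∈ᵇ P → y ∈ᵇ P →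
                       (position x P ≡ position y P) ⇔ x ≈ y
    position-correct (C ∷ P) (cohC ∷ cohP) (c≉P ∷ sepP) {x} {y} x∈ y∈
      with x ∈ᶜ? C | y ∈ᶜ? C | x∈ | y∈
    ... | yes x∈C | yes y∈C | _ | _ =
      mk⇔ (λ _ → ≈-trans (≈-sym (rep-≈ C cohC x∈C)) (rep-≈ C cohC y∈C)) (λ _ → refl)
    ... | yes x∈C | no  _ | _ | there y∈P =
      mk⇔ (λ ()) (λ x≈y → ⊥-elim (member-≉-later C P cohC cohP c≉P x∈C y∈P x≈y))
    ... | no  _ | yes y∈C | there x∈P | _ =
      mk⇔ (λ ()) (λ x≈y → ⊥-elim (member-≉-later C P cohC cohP c≉P y∈C x∈P (≈-sym x≈y)))
    ... | no  _ | no  _ | there x∈P | there y∈P =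
      let x~y = position-correct P cohP sepP x∈P y∈P in
      mk⇔ (λ eq → Equivalence.to x~y (suc-injective eq))
          (λ x≈y → cong suc (Equivalence.from x~y x≈y))
    ... | _ | no y∉C | _ | here y∈C = ⊥-elim (y∉C y∈C)
    ... | no x∉C | _ | here x∈C | _ = ⊥-elim (x∉C x∈C)

module Levels (n : ℕ) where

  open Interaction n
  open Scheduling n
  open Merging n

  occ : Fin n → List (Fin n) → ℕ
  occ x = count (Fin._≟ x)

  occ-unique : ∀ x {xs} → Unique xs → occ x xs ≤ 1
  occ-unique x [] = z≤n
  occ-unique x {y ∷ ys} (y∉ys ∷ unique) with y Fin.≟ x
  ... | no  _    = occ-unique x unique
  ... | yes refl = s≤s (subst (_≤ 0) (sym (absent ys y∉ys)) z≤n)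
    where
      absent : ∀ zs → All (y ≢_) zs → occ y zs ≡ 0
      absent [] [] = refl
      absent (z ∷ zs) (y≢z ∷ y∉zs) with z Fin.≟ y
      ... | yes z≡y = ⊥-elim (y≢z (sym z≡y))
      ... | no  _   = absent zs y∉zs

  incidences-row : ∀ x a bs →
                   count (incident? x) (map (a ,_) bs) ≤ occ x (a ∷ []) * length bs + occ x bs
  incidences-row x a bs rewrite count-map (incident? x) (a ,_) bs with a Fin.≟ x
  ... | yes _  = ≤-trans (count-≤-length _ bs) (≤-trans (m≤m+n (length bs) 0) (m≤m+n _ (occ x bs)))
  ... | no a≢x = count-mono _ (Fin._≟ x) [ (λ a≡x → ⊥-elim (a≢x a≡x)) , id ] bs

  incidences-cartesianProduct : ∀ x as bs →
    count (incident? x) (cartesianProduct as bs) ≤ occ x as * length bs + length as * occ x bs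
  incidences-cartesianProduct x [] bs = z≤n
  incidences-cartesianProduct x (a ∷ as) bs = begin
      count (incident? x) (map (a ,_) bs ++ cartesianProduct as bs)
    ≡⟨ count-++ (incident? x) (map (a ,_) bs) _ ⟩
      count (incident? x) (map (a ,_) bs) + count (incident? x) (cartesianProduct as bs)
    ≤⟨ +-mono-≤ (incidences-row x a bs) (incidences-cartesianProduct x as bs) ⟩
      (occ x (a ∷ []) * length bs + occ x bs) + (occ x as * length bs + length as * occ x bs)
    ≡⟨ distribute (occ x (a ∷ [])) (occ x as) (length bs) (occ x bs) (length as) ⟩
      (occ x (a ∷ []) + occ x as) * length bs + suc (length as) * occ x bs
    ≡⟨ cong (λ o → o * length bs + suc (length as) * occ x bs)
            (sym (count-++ (Fin._≟ x) (a ∷ []) as)) ⟩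
      occ x (a ∷ as) * length bs + length (a ∷ as) * occ x bs
    ∎
    where
      open ≤-Reasoning
      distribute : ∀ o o' l p q → (o * l + p) + (o' * l + q * p) ≡ (o + o') * l + suc q * p
      distribute = solve-∀

  module _ (k : ℕ) where

    incidences-crossPairs : ∀ x Ps → All (λ P → length (reps P) ≤ k) Ps →
                            count (incident? x) (crossPairs Ps) ≤ k * occ x (allReps Ps)
    incidences-crossPairs x [] _ = z≤n
    incidences-crossPairs x (P ∷ []) _ = z≤n
    incidences-crossPairs x (P ∷ Q ∷ Ps) (|P|≤k ∷ |Q|≤k ∷ small) = begin
        count (incident? x) (cartesianProduct (reps P) (reps Q) ++ crossPairs Ps)
      ≡⟨ count-++ (incident? x) (cartesianProduct (reps P) (reps Q)) (crossPairs Ps) ⟩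
        count (incident? x) (cartesianProduct (reps P) (reps Q))
          + count (incident? x) (crossPairs Ps)
      ≤⟨ +-mono-≤ (incidences-cartesianProduct x (reps P) (reps Q))
                  (incidences-crossPairs x Ps small) ⟩
        (oP * length (reps Q) + length (reps P) * oQ) + k * oR
      ≤⟨ +-monoˡ-≤ (k * oR) (+-mono-≤ (*-monoʳ-≤ oP |Q|≤k) (*-monoˡ-≤ oQ |P|≤k)) ⟩
        (oP * k + k * oQ) + k * oR
      ≡⟨ factor oP oQ oR k ⟩
        k * (oP + (oQ + oR))
      ≡⟨ cong (λ o → k * (oP + o)) (sym (count-++ (Fin._≟ x) (reps Q) (allReps Ps))) ⟩
        k * (oP + occ x (reps Q ++ allReps Ps))
      ≡⟨ cong (k *_) (sym (count-++ (Fin._≟ x) (reps P) (reps Q ++ allReps Ps))) ⟩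
        k * occ x (allReps (P ∷ Q ∷ Ps))
      ∎
      where
        open ≤-Reasoning
        oP = occ x (reps P)
        oQ = occ x (reps Q)
        oR = occ x (allReps Ps)
        factor : ∀ p q r k → (p * k + k * q) + k * r ≡ k * (p + (q + r))
        factor = solve-∀

  nonLoop? : ∀ (e : Pair) → Dec (proj₁ e ≢ proj₂ e)
  nonLoop? (a , b) = ¬? (a Fin.≟ b)

  testsOf : List Block → List Pair
  testsOf Ps = filter nonLoop? (crossPairs Ps)

  degree-testsOf : ∀ k Ps → All (λ P → length (reps P) ≤ k) Ps → Unique (allReps Ps) →
                   ∀ e → degree (testsOf Ps) e ≤ k + k
  degree-testsOf k Ps small distinct (a , b) = begin
      degree (testsOf Ps) (a , b)
    ≤⟨ count-mono-⊆ (adjacent? (a , b)) (filter-⊆ _ (crossPairs Ps)) ⟩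
      degree (crossPairs Ps) (a , b)
    ≤⟨ count-⊎ (incident? a) (incident? b) (adjacent? (a , b)) id (crossPairs Ps) ⟩
      count (incident? a) (crossPairs Ps) + count (incident? b) (crossPairs Ps)
    ≤⟨ +-mono-≤ (load a) (load b) ⟩
      k + k
    ∎
    where
      open ≤-Reasoning
      load : ∀ x → count (incident? x) (crossPairs Ps) ≤ k
      load x = ≤-trans (incidences-crossPairs k x Ps small)
                 (≤-trans (*-monoʳ-≤ k (occ-unique x distinct)) (≤-reflexive (*-identityʳ k)))

  open DecMembership (≡-dec (≡-dec (Fin._≟_ {n}) (Fin._≟_ {n})) Bool._≟_)
    using () renaming (_∈?_ to _∈ᵃ?_)

  -- A pair (a , a) cannot be tested in an exclusive-read round, so it is judged equivalent outright.
  Judged : Answers → Fin n → Fin n → Set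
  Judged ans a b = a ≡ b ⊎ ((a , b) , true) ∈ ans

  judged? : ∀ ans a b → Dec (Judged ans a b)
  judged? ans a b = (a Fin.≟ b) ⊎-dec (((a , b) , true) ∈ᵃ? ans)

  levels : ℕ → List Block → Prog (List Block)
  levels zero    Ps = return Ps
  levels (suc l) Ps =
    testAll (length (testsOf Ps)) (testsOf Ps) [] >>= λ ans →
    levels l (mergePairs (judged? ans) Ps)

  singletons : List Block
  singletons = map (λ x → (x , []) ∷ []) (allFin n)

  label : List Block → Fin n → ℕ
  label []      x = 0
  label (P ∷ _) x = position x P

  sortClasses : Prog (Fin n → ℕ)
  sortClasses = levels ⌈log₂ n ⌉ singletons >>= λ Ps → return (label Ps)

  module LevelsCorrectness (R : EqRel n) where

    open Correctness R

    record Invariant (Ps : List Block) : Set where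
      field
        cover     : ∀ x → Any (x ∈ᵇ_) Ps
        coherent  : All (All Coherent) Ps
        separated : All Separated Ps
        distinct  : Unique (allReps Ps)
    open Invariant

    mergePairs-invariant : ∀ {J : Fin n → Fin n → Set} (J? : Decidable J) → (∀ {a b} → J a b → a ≈ b) →
                           ∀ {Ps} → (∀ {a b} → (a , b) ∈ crossPairs Ps → a ≈ b → J a b) →
                           Invariant Ps → Invariant (mergePairs J? Ps)
    mergePairs-invariant J? sound {Ps} complete inv = record
      { cover     = λ x → mergePairs-cover J? Ps (cover inv x)
      ; coherent  = mergePairs-coherent J? sound Ps (coherent inv)
      ; separated = mergePairs-separated J? sound Ps (separated inv) complete
      ; distinct  = AllPairs-resp-⊆ (allReps-mergePairs-⊆ J? Ps) (distinct inv)
      }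

    true-outcome : ∀ {a b} → a ≈ b → outcome R (a , b) ≡ ((a , b) , true)
    true-outcome {a} {b} a≈b with test R a b
    ... | yes _  = refl
    ... | no a≉b = ⊥-elim (a≉b a≈b)

    judged-sound : ∀ {ans} → Truthful R ans → ∀ {a b} → Judged ans a b → a ≈ b
    judged-sound _ (inj₁ refl) = ≈-refl
    judged-sound truthful {a} {b} (inj₂ ab∈) with test R a b | All.lookup truthful ab∈
    ... | yes a≈b | _  = a≈b
    ... | no  _   | ()

    judged-complete : ∀ {ans a b} → Recorded R ans (a , b) → a ≈ b → Judged ans a b
    judged-complete recorded a≈b = inj₂ (subst (_∈ _) (true-outcome a≈b) recorded)

    label-correct : ∀ Ps → Invariant Ps → length Ps ≤ 1 → ∀ x y →
                    (label Ps x ≡ label Ps y) ⇔ x ≈ y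
    label-correct [] inv _ x y with cover inv x
    ... | ()
    label-correct (P ∷ []) inv _ x y with cover inv x | cover inv y
    ... | here x∈P | here y∈P =
      position-correct P (All.head (coherent inv)) (All.head (separated inv)) x∈P y∈P
    label-correct (P ∷ Q ∷ Ps) inv (s≤s ())

    module _ {k : ℕ} (classes : HasClasses R k) where

      reps-bounded : ∀ P → Separated P → length (reps P) ≤ k
      reps-bounded P separated =
        let f , _ , f≡⇔≈ = classes in
        subst (_≤ k) (length-map f (reps P))
          (Unique⇒length≤ (AllPairs.map⁺
            (AllPairs.map (λ a≉b fa≡fb → a≉b (Equivalence.to (f≡⇔≈ _ _) fa≡fb)) separated)))

      levels-spec : ∀ l Ps → Invariant Ps → ⌈log₂ length Ps ⌉ ≤ l →
                    HaltsWithin R (l * (k + k)) (levels l Ps) (λ Ps' → Invariant Ps' × length Ps' ≤ 1)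
      levels-spec zero Ps inv log≤0 = inv , ⌈log₂⌉≤0⇒≤1 (length Ps) log≤0
        where
          ⌈log₂⌉≤0⇒≤1 : ∀ m → ⌈log₂ m ⌉ ≤ 0 → m ≤ 1
          ⌈log₂⌉≤0⇒≤1 zero          _ = z≤n
          ⌈log₂⌉≤0⇒≤1 (suc zero)    _ = ≤-refl
          ⌈log₂⌉≤0⇒≤1 (suc (suc m)) log≤0
            with ≤-trans (⌈log₂⌉-mono-≤ {2} {suc (suc m)} (s≤s (s≤s z≤n))) log≤0
          ... | ()
      levels-spec (suc l) Ps inv log≤ =
        HaltsWithin->>= R (k + k) (l * (k + k)) (testAll (length U) U []) _
          (testAll-spec R (k + k) (length U) U [] ≤-refl loopless
             (λ {e} _ → degree-testsOf k Ps (All.map (λ {P} → reps-bounded P) (separated inv))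
                                        (distinct inv) e)
             [])
          (λ ans (truthful , _ , recorded) →
             levels-spec l (mergePairs (judged? ans) Ps)
               (mergePairs-invariant (judged? ans) (judged-sound truthful) (complete recorded) inv)
               (log-halves (judged? ans)))
        where
          U = testsOf Ps

          loopless : ∀ {e} → e ∈ U → proj₁ e ≢ proj₂ e
          loopless e∈ = proj₂ (∈-filter⁻ nonLoop? {xs = crossPairs Ps} e∈)

          complete : ∀ {ans} → (∀ {e} → e ∈ U → Recorded R ans e) →
                     ∀ {a b} → (a , b) ∈ crossPairs Ps → a ≈ b → Judged ans a b
          complete recorded {a} {b} ab∈ a≈b with a Fin.≟ b
          ... | yes a≡b = inj₁ a≡b
          ... | no  a≢b = judged-complete (recorded (∈-filter⁺ nonLoop? ab∈ a≢b)) a≈b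

          log-halves : ∀ {J : Fin n → Fin n → Set} (J? : Decidable J) →
                       ⌈log₂ length (mergePairs J? Ps) ⌉ ≤ l
          log-halves J? = begin
              ⌈log₂ length (mergePairs J? Ps) ⌉
            ≡⟨ cong ⌈log₂_⌉ (mergePairs-length J? Ps) ⟩
              ⌈log₂ ⌈ length Ps /2⌉ ⌉
            ≡⟨ ⌈log₂⌈n/2⌉⌉≡⌈log₂n⌉∸1 (length Ps) ⟩
              ⌈log₂ length Ps ⌉ ∸ 1
            ≤⟨ ∸-monoˡ-≤ 1 log≤ ⟩
              l
            ∎
            where open ≤-Reasoning

    allReps-singletons : ∀ xs → allReps (map (λ x → (x , []) ∷ []) xs) ≡ xs
    allReps-singletons [] = refl
    allReps-singletons (x ∷ xs) = cong (x ∷_) (allReps-singletons xs)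

    singletons-invariant : Invariant singletons
    singletons-invariant = record
      { cover     = λ x → Any.map⁺ (Any.map (λ { refl → here (inj₁ refl) }) (∈-allFin x))
      ; coherent  = All.map⁺ (All.universal (λ _ → [] ∷ []) (allFin n))
      ; separated = All.map⁺ (All.universal (λ _ → [] ∷ []) (allFin n))
      ; distinct  = subst Unique (sym (allReps-singletons (allFin n))) (allFin⁺ n)
      }

    sortClasses-spec : ∀ {k} → HasClasses R k →
                       HaltsWithin R (2 * k * ⌈log₂ n ⌉) sortClasses
                         (λ f → ∀ x y → (f x ≡ f y) ⇔ x ≈ y)
    sortClasses-spec {k} classes =
      HaltsWithin-mono R sortClasses (≤-reflexive (rounds ⌈log₂ n ⌉ k)) id
        (HaltsWithin->>= R (⌈log₂ n ⌉ * (k + k)) 0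
          (levels ⌈log₂ n ⌉ singletons) (λ Ps → return (label Ps))
          (levels-spec classes ⌈log₂ n ⌉ singletons singletons-invariant
             (≤-reflexive (cong ⌈log₂_⌉ (trans (length-map _ (allFin n))
                                                (length-tabulate {n = n} id)))))
          (λ Ps (inv , ≤1) → label-correct Ps inv ≤1))
      where
        rounds : ∀ l k → l * (k + k) + 0 ≡ 2 * k * l
        rounds = solve-∀

mainTheorem2 : Σ ℕ λ c → (n : ℕ) → Σ (Algorithm n) λ A →
                 (k : ℕ) (R : EqRel n) → HasClasses R k →
                 SolvesWithin A R (c * k * ⌈log₂ n ⌉)
mainTheorem2 = 2 , λ n → toAlgorithm n (sortClasses n) , λ k R classes →
  run-toAlgorithm n R (2 * k * ⌈log₂ n ⌉) (sortClasses n) (sortClasses-spec n R classes)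
  where
    open Interaction using (toAlgorithm; run-toAlgorithm)
    open Levels using (sortClasses)
    open Levels.LevelsCorrectness using (sortClasses-spec)
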